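{- Let $k\ge 3$ be an integer and let $G$ be a $k$-regular graph. The strong chromatic index of $G$ equals $2k-1$ if and only if $G$ covers the Kneser graph $K(2k-1,k-1)$, i.e., there is a covering projection $G\to K(2k-1,k-1)$.
   Context: A strong edge coloring of a graph is a proper edge coloring with no bichromatic path of length three; the strong chromatic index $\chi_s'(G)$ is the minimum number of colors in a strong edge coloring of $G$. For $m\ge 2n+1$ and $n\ge 2$, the Kneser graph $K(m,n)$ has as vertices the $n$-element subsets of $\{1,\dots,m\}$, two vertices being adjacent iff the subsets are disjoint. A surjective graph homomorphism $f\colon\tilde G\to G$ is a covering projection if for every vertex $\tilde v$ of $\tilde G$ the set of edges incident with $\tilde v$ is mapped bijectively onto the set of edges incident with $f(\tilde v)$; $\tilde G$ covers $G$ if such a projection exists. -}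

module Defs where

open import Data.Nat using (ℕ; _≤_)
open import Data.Fin using (Fin)
open import Data.Fin.Subset using (Subset; _∈_; _∉_; ∣_∣; inside; outside)
open import Data.Vec using (tabulate)
open import Data.Product using (Σ; ∃; _×_; _,_)
open import Data.Sum using (_⊎_)
open import Relation.Nullary using (¬_; Dec; yes; no)
open import Relation.Binary.PropositionalEquality using (_≡_; _≢_)

record Graph (V : Set) : Set₁ where
  field
    Adj : V → V → Set
    Adj-sym : ∀ {u v} → Adj u v → Adj v u
open Graph public

record FinGraph (n : ℕ) : Set₁ where
  field
    graph  : Graph (Fin n)
    irrefl : ∀ v → ¬ Adj graph v v
    adj?   : ∀ u v → Dec (Adj graph u v)
open FinGraph public

nbhd : ∀ {n} (G : FinGraph n) → Fin n → Subset n
nbhd G v = tabulate λ w → decide (adj? G v w)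
  where
  decide : ∀ {P : Set} → Dec P → _
  decide (yes _) = inside
  decide (no _)  = outside

degree : ∀ {n} (G : FinGraph n) → Fin n → ℕ
degree G v = ∣ nbhd G v ∣

Regular : ∀ {n} → FinGraph n → ℕ → Set
Regular G k = ∀ v → degree G v ≡ k

Bichromatic : ∀ {V : Set} {m : ℕ} → (V → V → Fin m) → V → V → V → V → Set
Bichromatic c u v w x =
  Σ _ λ a → Σ _ λ b → a ≢ b ×
    ((c u v ≡ a ⊎ c u v ≡ b) × (c v w ≡ a ⊎ c v w ≡ b) × (c w x ≡ a ⊎ c w x ≡ b))

-- A strong edge colouring with (at most) m colours.  An edge {u,v} gets the
-- colour c u v (= c v u); values of c on non-edges are irrelevant.
record StrongEdgeColouring {V : Set} (G : Graph V) (m : ℕ) : Set where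
  field
    col    : V → V → Fin m
    col-sym : ∀ {u v} → Adj G u v → col u v ≡ col v u
    proper : ∀ {u v w} → Adj G u v → Adj G u w → v ≢ w → col u v ≢ col u w
    noBichromaticP3 : ∀ {u v w x} → Adj G u v → Adj G v w → Adj G w x →
      u ≢ v → u ≢ w → u ≢ x → v ≢ w → v ≢ x → w ≢ x →
      ¬ Bichromatic col u v w x

StrongChromaticIndex : ∀ {V : Set} → Graph V → ℕ → Set
StrongChromaticIndex G m =
  StrongEdgeColouring G m × (∀ m' → StrongEdgeColouring G m' → m ≤ m')

KneserV : ℕ → ℕ → Set
KneserV m n = Σ (Subset m) λ s → ∣ s ∣ ≡ n

Kneser : (m n : ℕ) → Graph (KneserV m n)
Kneser m n = record
  { Adj = λ { (s , _) (t , _) → ∀ x → x ∈ s → x ∉ t }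
  ; Adj-sym = λ { {s , _} {t , _} d x x∈t x∈s → d x x∈s x∈t }
  }

-- Covering projection f : G̃ → G: a surjective homomorphism that maps the
-- edges at each vertex ṽ bijectively onto the edges at f ṽ.  In a simple
-- graph the edges at ṽ are {ṽ,w̃} for neighbours w̃, and {ṽ,w̃} ↦ {f ṽ, f w̃},
-- so this is bijectivity of w̃ ↦ f w̃ from N(ṽ) onto N(f ṽ).
record CoveringProjection {V W : Set} (G̃ : Graph V) (G : Graph W) (f : V → W) : Set where
  field
    hom        : ∀ {u v} → Adj G̃ u v → Adj G (f u) (f v)
    surjective : ∀ y → ∃ λ x → f x ≡ y
    locInj     : ∀ {v w w'} → Adj G̃ v w → Adj G̃ v w' → f w ≡ f w' → w ≡ w'
    locSurj    : ∀ {v y} → Adj G (f v) y → ∃ λ w → Adj G̃ v w × f w ≡ y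

Covers : ∀ {V W : Set} → Graph V → Graph W → Set
Covers G̃ G = ∃ λ f → CoveringProjection G̃ G f

-- Write k = j + 1 and m = 2k - 1.  In a strong edge colouring of a k-regular graph the k
-- colours at u and the k colours at a neighbour v share only the colour of uv, so m colours
-- are always needed, and with exactly m colours the colour sets of adjacent vertices cover all
-- colours.  Sending v to the (k-1)-set of colours missing at v then maps adjacent vertices to
-- disjoint sets and the neighbours of v bijectively onto the Kneser neighbours of its image;
-- surjectivity follows since any two (k-1)-sets are joined by exchange steps, each realised by
-- a walk of length two.  Conversely, for a covering f the set f u ∪ f v of an edge uv misses
-- exactly one colour; giving uv that colour is a strong edge colouring, because f v is the
-- complement of f u with the colour of uv removed.

module Submission where

open import Defs
open import Data.Nat using (ℕ; zero; suc; _+_; _*_; _∸_; _≤_; _<_; z≤n; s≤s; z<s)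
open import Data.Nat.Properties
  using (+-suc; +-comm; +-identityʳ; +-monoʳ-≤; +-monoʳ-<; suc-injective; ≡-irrelevant;
         ≤-refl; ≤-reflexive; ≤-trans; ≤-antisym; ≤-pred; <⇒≤; <⇒≱; >⇒≢; ≤-<-trans; <-≤-trans;
         m<m+n; m<n⇒0<n∸m; m+n∸n≡m; m+n∸m≡n; module ≤-Reasoning)
open import Data.Fin using (Fin; zero; suc; _≟_; fromℕ<)
import Data.Fin.Properties as Fin
open import Data.Fin.Subset
open import Data.Fin.Subset.Properties
open import Data.Vec using (_∷_; []; here; there)
open import Data.Vec.Properties using (lookup∘tabulate; []=⇒lookup; lookup⇒[]=)
open import Data.Bool using (true; false)
open import Data.Product using (∃; _×_; _,_; proj₁; proj₂; uncurry)
open import Data.Sum using (_⊎_; inj₁; inj₂)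
open import Data.Empty using (⊥-elim)
open import Function using (_∘_)
open import Function.Bundles using (_⇔_; mk⇔)
open import Relation.Nullary using (¬_; yes; no; contradiction)
open import Relation.Nullary.Decidable using (decidable-stable)
open import Relation.Binary.PropositionalEquality

∣p∪q∣+∣p∩q∣≡∣p∣+∣q∣ : ∀ {n} (p q : Subset n) → ∣ p ∪ q ∣ + ∣ p ∩ q ∣ ≡ ∣ p ∣ + ∣ q ∣
∣p∪q∣+∣p∩q∣≡∣p∣+∣q∣ [] [] = refl
∣p∪q∣+∣p∩q∣≡∣p∣+∣q∣ (true ∷ p) (true ∷ q) =
  cong suc (trans (+-suc _ _) (trans (cong suc (∣p∪q∣+∣p∩q∣≡∣p∣+∣q∣ p q)) (sym (+-suc _ _))))
∣p∪q∣+∣p∩q∣≡∣p∣+∣q∣ (true ∷ p) (false ∷ q) = cong suc (∣p∪q∣+∣p∩q∣≡∣p∣+∣q∣ p q)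
∣p∪q∣+∣p∩q∣≡∣p∣+∣q∣ (false ∷ p) (true ∷ q) = trans (cong suc (∣p∪q∣+∣p∩q∣≡∣p∣+∣q∣ p q)) (sym (+-suc _ _))
∣p∪q∣+∣p∩q∣≡∣p∣+∣q∣ (false ∷ p) (false ∷ q) = ∣p∪q∣+∣p∩q∣≡∣p∣+∣q∣ p q

Empty⇒∣p∣≡0 : ∀ {n} {p : Subset n} → Empty p → ∣ p ∣ ≡ 0
Empty⇒∣p∣≡0 {n} p-empty = trans (cong ∣_∣ (Empty-unique p-empty)) (∣⊥∣≡0 n)

0<∣p∣⇒Nonempty : ∀ {n} {p : Subset n} → 0 < ∣ p ∣ → Nonempty p
0<∣p∣⇒Nonempty {p = p} 0<∣p∣ with nonempty? p
... | yes p-nonempty = p-nonempty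
... | no p-empty = contradiction (Empty⇒∣p∣≡0 p-empty) (>⇒≢ 0<∣p∣)

∣p∪q∣≡∣p∣+∣q∣ : ∀ {n} {p q : Subset n} → (∀ x → x ∈ p → x ∉ q) → ∣ p ∪ q ∣ ≡ ∣ p ∣ + ∣ q ∣
∣p∪q∣≡∣p∣+∣q∣ {p = p} {q} disjoint = begin
  ∣ p ∪ q ∣               ≡⟨ sym (+-identityʳ _) ⟩
  ∣ p ∪ q ∣ + 0           ≡⟨ cong (∣ p ∪ q ∣ +_) (sym (Empty⇒∣p∣≡0 p∩q-empty)) ⟩
  ∣ p ∪ q ∣ + ∣ p ∩ q ∣   ≡⟨ ∣p∪q∣+∣p∩q∣≡∣p∣+∣q∣ p q ⟩
  ∣ p ∣ + ∣ q ∣           ∎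
  where
  open ≡-Reasoning
  p∩q-empty : Empty (p ∩ q)
  p∩q-empty (x , x∈p∩q) = uncurry (disjoint x) (x∈p∩q⁻ p q x∈p∩q)

∣p∪⁅x⁆∣≡1+∣p∣ : ∀ {n} {p : Subset n} {x} → x ∉ p → ∣ p ∪ ⁅ x ⁆ ∣ ≡ suc ∣ p ∣
∣p∪⁅x⁆∣≡1+∣p∣ {p = p} {x} x∉p =
  trans (∣p∪q∣≡∣p∣+∣q∣ disjoint) (trans (cong (∣ p ∣ +_) (∣⁅x⁆∣≡1 x)) (+-comm ∣ p ∣ 1))
  where
  disjoint : ∀ y → y ∈ p → y ∉ ⁅ x ⁆
  disjoint y y∈p y∈⁅x⁆ = x∉p (subst (_∈ p) (x∈⁅y⁆⇒x≡y x y∈⁅x⁆) y∈p)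

1+∣p-x∣≡∣p∣ : ∀ {n} {p : Subset n} {x} → x ∈ p → suc ∣ p - x ∣ ≡ ∣ p ∣
1+∣p-x∣≡∣p∣ {p = true ∷ p} here = cong (suc ∘ ∣_∣) (p─⊥≡p p)
1+∣p-x∣≡∣p∣ {p = true ∷ p} (there x∈p) = cong suc (1+∣p-x∣≡∣p∣ x∈p)
1+∣p-x∣≡∣p∣ {p = false ∷ p} (there x∈p) = 1+∣p-x∣≡∣p∣ x∈p

∣[p∪⁅y⁆]-x∣≡∣p∣ : ∀ {n} {p : Subset n} {x y} → x ∈ p → y ∉ p → ∣ (p ∪ ⁅ y ⁆) - x ∣ ≡ ∣ p ∣
∣[p∪⁅y⁆]-x∣≡∣p∣ x∈p y∉p =
  suc-injective (trans (1+∣p-x∣≡∣p∣ (x∈p∪q⁺ (inj₁ x∈p))) (∣p∪⁅x⁆∣≡1+∣p∣ y∉p))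

p⊆q∧∣q∣≤∣p∣⇒p≡q : ∀ {n} {p q : Subset n} → p ⊆ q → ∣ q ∣ ≤ ∣ p ∣ → p ≡ q
p⊆q∧∣q∣≤∣p∣⇒p≡q {p = []} {[]} _ _ = refl
p⊆q∧∣q∣≤∣p∣⇒p≡q {p = true ∷ p} {true ∷ q} p⊆q ∣q∣≤∣p∣ =
  cong (true ∷_) (p⊆q∧∣q∣≤∣p∣⇒p≡q (drop-∷-⊆ p⊆q) (≤-pred ∣q∣≤∣p∣))
p⊆q∧∣q∣≤∣p∣⇒p≡q {p = true ∷ p} {false ∷ q} p⊆q _ with p⊆q here
... | ()
p⊆q∧∣q∣≤∣p∣⇒p≡q {p = false ∷ p} {true ∷ q} p⊆q ∣q∣≤∣p∣ =
  contradiction (p⊆q⇒∣p∣≤∣q∣ (drop-∷-⊆ p⊆q)) (<⇒≱ ∣q∣≤∣p∣)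
p⊆q∧∣q∣≤∣p∣⇒p≡q {p = false ∷ p} {false ∷ q} p⊆q ∣q∣≤∣p∣ =
  cong (false ∷_) (p⊆q∧∣q∣≤∣p∣⇒p≡q (drop-∷-⊆ p⊆q) ∣q∣≤∣p∣)

x∈p─q⁻ : ∀ {n} {p q : Subset n} {x} → x ∈ p ─ q → x ∈ p × x ∉ q
x∈p─q⁻ {p = p} {q} x∈p─q = p─q⊆p p q x∈p─q , ∉q p q x∈p─q
  where
  ∉q : ∀ {n} (p q : Subset n) {x} → x ∈ p ─ q → x ∉ q
  ∉q (true ∷ p) (false ∷ q) here ()
  ∉q (_ ∷ p) (true ∷ q) (there x∈p─q) (there x∈q) = ∉q p q x∈p─q x∈q
  ∉q (_ ∷ p) (false ∷ q) (there x∈p─q) (there x∈q) = ∉q p q x∈p─q x∈q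

⊆-or-∈∉ : ∀ {n} (p q : Subset n) → p ⊆ q ⊎ ∃ λ x → x ∈ p × x ∉ q
⊆-or-∈∉ p q with nonempty? (p ─ q)
... | yes (x , x∈p─q) = inj₂ (x , x∈p─q⁻ x∈p─q)
... | no p─q-empty = inj₁ λ {x} x∈p →
  decidable-stable (x ∈? q) λ x∉q → p─q-empty (x , x∈p∧x∉q⇒x∈p─q x∈p x∉q)

p⊆q∧1+∣p∣≡∣q∣⇒p≡q-x : ∀ {n} {p q : Subset n} → p ⊆ q → suc ∣ p ∣ ≡ ∣ q ∣ →
  ∃ λ x → x ∈ q × p ≡ q - x
p⊆q∧1+∣p∣≡∣q∣⇒p≡q-x {p = p} {q} p⊆q 1+∣p∣≡∣q∣ with ⊆-or-∈∉ q p
... | inj₁ q⊆p = contradiction (p⊆q⇒∣p∣≤∣q∣ q⊆p) (<⇒≱ (≤-reflexive 1+∣p∣≡∣q∣))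
... | inj₂ (x , x∈q , x∉p) =
  x , x∈q , p⊆q∧∣q∣≤∣p∣⇒p≡q p⊆q-x (≤-reflexive (suc-injective (trans (1+∣p-x∣≡∣p∣ x∈q) (sym 1+∣p∣≡∣q∣))))
  where
  p⊆q-x : p ⊆ q - x
  p⊆q-x y∈p = x∈p∧x≢y⇒x∈p-y (p⊆q y∈p) λ { refl → x∉p y∈p }

outsider : ∀ {m} → Fin m → Subset m → Fin m
outsider d p with nonempty? (∁ p)
... | yes (x , _) = x
... | no _ = d

outsider-∉ : ∀ {m} (d : Fin m) (p : Subset m) → ∣ p ∣ < m → outsider d p ∉ p
outsider-∉ {m} d p ∣p∣<m with nonempty? (∁ p)
... | yes (_ , x∈∁p) = x∈∁p⇒x∉p x∈∁p
... | no ∁p-empty =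
  contradiction (0<∣p∣⇒Nonempty (subst (0 <_) (sym (∣∁p∣≡n∸∣p∣ p)) (m<n⇒0<n∸m ∣p∣<m))) ∁p-empty

image : ∀ {n m} → (Fin n → Fin m) → Subset n → Subset m
image g [] = ⊥
image g (true ∷ p) = image (g ∘ suc) p ∪ ⁅ g zero ⁆
image g (false ∷ p) = image (g ∘ suc) p

∈-image⁺ : ∀ {n m} (g : Fin n → Fin m) {p x} → x ∈ p → g x ∈ image g p
∈-image⁺ g {true ∷ p} here = x∈p∪q⁺ (inj₂ (x∈⁅x⁆ (g zero)))
∈-image⁺ g {true ∷ p} (there x∈p) = x∈p∪q⁺ (inj₁ (∈-image⁺ (g ∘ suc) x∈p))
∈-image⁺ g {false ∷ p} (there x∈p) = ∈-image⁺ (g ∘ suc) x∈p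

∈-image⁻ : ∀ {n m} (g : Fin n → Fin m) {p y} → y ∈ image g p → ∃ λ x → x ∈ p × g x ≡ y
∈-image⁻ g {[]} y∈ = ⊥-elim (∉⊥ y∈)
∈-image⁻ g {true ∷ p} y∈ with x∈p∪q⁻ (image (g ∘ suc) p) ⁅ g zero ⁆ y∈
... | inj₂ y∈⁅g0⁆ = zero , here , sym (x∈⁅y⁆⇒x≡y _ y∈⁅g0⁆)
... | inj₁ y∈image with ∈-image⁻ (g ∘ suc) y∈image
...   | x , x∈p , gx≡y = suc x , there x∈p , gx≡y
∈-image⁻ g {false ∷ p} y∈ with ∈-image⁻ (g ∘ suc) y∈
... | x , x∈p , gx≡y = suc x , there x∈p , gx≡y

InjectiveOn : ∀ {n m} → (Fin n → Fin m) → Subset n → Set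
InjectiveOn g p = ∀ {x y} → x ∈ p → y ∈ p → g x ≡ g y → x ≡ y

InjectiveOn-∷⁻ : ∀ {n m} {g : Fin (suc n) → Fin m} {s p} →
  InjectiveOn g (s ∷ p) → InjectiveOn (g ∘ suc) p
InjectiveOn-∷⁻ injective x∈p y∈p gx≡gy = Fin.suc-injective (injective (there x∈p) (there y∈p) gx≡gy)

∣image∣≡∣p∣ : ∀ {n m} (g : Fin n → Fin m) (p : Subset n) → InjectiveOn g p → ∣ image g p ∣ ≡ ∣ p ∣
∣image∣≡∣p∣ {m = m} g [] _ = ∣⊥∣≡0 m
∣image∣≡∣p∣ g (true ∷ p) injective =
  trans (∣p∪⁅x⁆∣≡1+∣p∣ g0∉image) (cong suc (∣image∣≡∣p∣ (g ∘ suc) p (InjectiveOn-∷⁻ injective)))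
  where
  g0∉image : g zero ∉ image (g ∘ suc) p
  g0∉image g0∈ with ∈-image⁻ (g ∘ suc) g0∈
  ... | x , x∈p , gx≡g0 with injective (there x∈p) here gx≡g0
  ...   | ()
∣image∣≡∣p∣ g (false ∷ p) injective = ∣image∣≡∣p∣ (g ∘ suc) p (InjectiveOn-∷⁻ injective)

module _ {n} (G : FinGraph n) where

  ∈-nbhd⁻ : ∀ {v w} → w ∈ nbhd G v → Adj (graph G) v w
  ∈-nbhd⁻ {v} {w} w∈ with adj? G v w | trans (sym (lookup∘tabulate _ w)) ([]=⇒lookup w∈)
  ... | yes v~w | _ = v~w
  ... | no _ | ()

  ∈-nbhd⁺ : ∀ {v w} → Adj (graph G) v w → w ∈ nbhd G v
  ∈-nbhd⁺ {v} {w} v~w with adj? G v w | lookup⇒[]= w (nbhd G v) ∘ trans (lookup∘tabulate _ w)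
  ... | yes _ | w∈ = w∈ refl
  ... | no v≁w | _ = contradiction v~w v≁w

module ColourSets {n} (G : FinGraph n) {m} (C : StrongEdgeColouring (graph G) m) where
  open StrongEdgeColouring C

  private
    _~_ : Fin n → Fin n → Set
    _~_ = Adj (graph G)

    ~-sym : ∀ {u v} → u ~ v → v ~ u
    ~-sym = Adj-sym (graph G)

    ~⇒≢ : ∀ {u v} → u ~ v → u ≢ v
    ~⇒≢ {u} u~u refl = irrefl G u u~u

  colours : Fin n → Subset m
  colours v = image (col v) (nbhd G v)

  ∈-colours⁺ : ∀ {v w} → v ~ w → col v w ∈ colours v
  ∈-colours⁺ v~w = ∈-image⁺ _ (∈-nbhd⁺ G v~w)

  ∈-colours⁺ʳ : ∀ {v w} → v ~ w → col v w ∈ colours w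
  ∈-colours⁺ʳ v~w = subst (_∈ colours _) (col-sym (~-sym v~w)) (∈-colours⁺ (~-sym v~w))

  ∈-colours⁻ : ∀ {v c} → c ∈ colours v → ∃ λ w → v ~ w × col v w ≡ c
  ∈-colours⁻ c∈ with ∈-image⁻ _ c∈
  ... | w , w∈nbhd , colw≡c = w , ∈-nbhd⁻ G w∈nbhd , colw≡c

  ∣colours∣≡degree : ∀ v → ∣ colours v ∣ ≡ degree G v
  ∣colours∣≡degree v = ∣image∣≡∣p∣ (col v) (nbhd G v) injective
    where
    injective : InjectiveOn (col v) (nbhd G v)
    injective {w} {w'} w∈ w'∈ colw≡colw' with w ≟ w'
    ... | yes w≡w' = w≡w'
    ... | no w≢w' = contradiction colw≡colw' (proper (∈-nbhd⁻ G w∈) (∈-nbhd⁻ G w'∈) w≢w')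

  -- A second common colour would sit on edges a u and v b, making a-u-v-b bichromatic.
  common-colour≡col : ∀ {u v x} → u ~ v → x ∈ colours u → x ∈ colours v → x ≡ col u v
  common-colour≡col {u} {v} {x} u~v x∈u x∈v with x ≟ col u v
  ... | yes x≡c = x≡c
  ... | no x≢c with ∈-colours⁻ x∈u | ∈-colours⁻ x∈v
  ...   | a , u~a , cua≡x | b , v~b , cvb≡x with a ≟ v | b ≟ u | a ≟ b
  ...     | yes refl | _ | _ = contradiction (sym cua≡x) x≢c
  ...     | no _ | yes refl | _ = contradiction (trans (sym cvb≡x) (sym (col-sym u~v))) x≢c
  ...     | no _ | no _ | yes refl =
    contradiction (trans (col-sym (~-sym u~a)) (trans cua≡x (trans (sym cvb≡x) (sym (col-sym (~-sym v~b))))))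
                  (proper (~-sym u~a) (~-sym v~b) (~⇒≢ u~v))
  ...     | no a≢v | no b≢u | no a≢b = ⊥-elim (
    noBichromaticP3 (~-sym u~a) u~v v~b
      (~⇒≢ u~a ∘ sym) a≢v a≢b (~⇒≢ u~v) (b≢u ∘ sym) (~⇒≢ v~b)
      (x , col u v , x≢c , inj₁ (trans (col-sym (~-sym u~a)) cua≡x) , inj₂ refl , inj₁ cvb≡x))

  degree+degree≤1+∣colours∪colours∣ : ∀ {u v} → u ~ v →
    degree G u + degree G v ≤ suc ∣ colours u ∪ colours v ∣
  degree+degree≤1+∣colours∪colours∣ {u} {v} u~v = begin
    degree G u + degree G v               ≡⟨ sym (cong₂ _+_ (∣colours∣≡degree u) (∣colours∣≡degree v)) ⟩
    ∣ colours u ∣ + ∣ colours v ∣          ≡⟨ sym (∣p∪q∣+∣p∩q∣≡∣p∣+∣q∣ (colours u) (colours v)) ⟩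
    ∣ colours u ∪ colours v ∣ + ∣ colours u ∩ colours v ∣ ≤⟨ +-monoʳ-≤ _ ∣∩∣≤1 ⟩
    ∣ colours u ∪ colours v ∣ + 1          ≡⟨ +-comm _ 1 ⟩
    suc ∣ colours u ∪ colours v ∣          ∎
    where
    open ≤-Reasoning
    ∣∩∣≤1 : ∣ colours u ∩ colours v ∣ ≤ 1
    ∣∩∣≤1 = subst (∣ colours u ∩ colours v ∣ ≤_) (∣⁅x⁆∣≡1 (col u v)) (p⊆q⇒∣p∣≤∣q∣ λ x∈∩ →
      let (x∈u , x∈v) = x∈p∩q⁻ (colours u) (colours v) x∈∩
      in subst (_∈ ⁅ col u v ⁆) (sym (common-colour≡col u~v x∈u x∈v)) (x∈⁅x⁆ (col u v)))

  regular⇒k+k≤1+∣colours∪colours∣ : ∀ {k u v} → Regular G k → u ~ v →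
    k + k ≤ suc ∣ colours u ∪ colours v ∣
  regular⇒k+k≤1+∣colours∪colours∣ {u = u} {v} regular u~v =
    subst₂ (λ a b → a + b ≤ suc ∣ colours u ∪ colours v ∣) (regular u) (regular v)
           (degree+degree≤1+∣colours∪colours∣ u~v)

module _ {n} (G : FinGraph n) {j} (regular : Regular G (suc j)) where

  neighbour : ∀ v → ∃ λ w → Adj (graph G) v w
  neighbour v with 0<∣p∣⇒Nonempty (subst (0 <_) (sym (regular v)) z<s)
  ... | w , w∈nbhd = w , ∈-nbhd⁻ G w∈nbhd

  regular⇒2k∸1≤colours : Fin n → ∀ {m} → StrongEdgeColouring (graph G) m → j + suc j ≤ m
  regular⇒2k∸1≤colours v C with neighbour v
  ... | w , v~w =
    ≤-trans (≤-pred (regular⇒k+k≤1+∣colours∪colours∣ regular v~w)) (∣p∣≤n (colours v ∪ colours w))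
    where open ColourSets G C

KneserV-≡ : ∀ {m j} {S T : KneserV m j} → proj₁ S ≡ proj₁ T → S ≡ T
KneserV-≡ {S = S , ∣S∣} {.S , ∣S∣'} refl = cong (S ,_) (≡-irrelevant ∣S∣ ∣S∣')

subset-of-size : ∀ {m j} → j ≤ m → KneserV m j
subset-of-size {m} {zero} _ = ⊥ , ∣⊥∣≡0 m
subset-of-size {suc m} {suc j} (s≤s j≤m) with subset-of-size j≤m
... | S , ∣S∣ = inside ∷ S , cong suc ∣S∣

module OddSize {j m : ℕ} (m≡ : m ≡ j + suc j) where

  m∸[1+j]≡j : m ∸ suc j ≡ j
  m∸[1+j]≡j = trans (cong (_∸ suc j) m≡) (m+n∸n≡m j (suc j))

  m∸j≡1+j : m ∸ j ≡ suc j
  m∸j≡1+j = trans (cong (_∸ j) m≡) (m+n∸m≡n j (suc j))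

  j<m : j < m
  j<m = subst (j <_) (sym m≡) (m<m+n j z<s)

  j+j<m : j + j < m
  j+j<m = subst (j + j <_) (sym m≡) (+-monoʳ-< j ≤-refl)

  ∣∁S∪⁅x⁆∣≡j : ∀ {S : Subset m} {x} → ∣ S ∣ ≡ j → x ∉ S → ∣ ∁ (S ∪ ⁅ x ⁆) ∣ ≡ j
  ∣∁S∪⁅x⁆∣≡j {S} ∣S∣≡j x∉S = begin
    ∣ ∁ (S ∪ ⁅ _ ⁆) ∣   ≡⟨ ∣∁p∣≡n∸∣p∣ (S ∪ ⁅ _ ⁆) ⟩
    m ∸ ∣ S ∪ ⁅ _ ⁆ ∣   ≡⟨ cong (m ∸_) (trans (∣p∪⁅x⁆∣≡1+∣p∣ x∉S) (cong suc ∣S∣≡j)) ⟩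
    m ∸ suc j           ≡⟨ m∸[1+j]≡j ⟩
    j                   ∎
    where open ≡-Reasoning

module KneserLift {V : Set} (G : Graph V) {j m} (m≡ : m ≡ j + suc j) (f : V → KneserV m j)
  (lift : ∀ {v y} → Adj (Kneser m j) (f v) y → ∃ λ w → Adj G v w × f w ≡ y) where
  open OddSize m≡

  InImage : Subset m → Set
  InImage S = ∃ λ v → proj₁ (f v) ≡ S

  -- ∁ (S ∪ ⁅ c ⁆) is a common Kneser neighbour of S and (S ∪ ⁅ c ⁆) - s.
  InImage-exchange : ∀ {S s c} → ∣ S ∣ ≡ j → s ∈ S → c ∉ S → InImage S → InImage ((S ∪ ⁅ c ⁆) - s)
  InImage-exchange {S} {s} {c} ∣S∣≡j s∈S c∉S (v , fv≡S) =
    let (w , _ , fw≡t) = lift {v} {t} fv~t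
        (z , _ , fz≡s') = lift {w} {s'} (subst (λ y → Adj (Kneser m j) y s') (sym fw≡t) t~s')
    in z , cong proj₁ fz≡s'
    where
    t s' : KneserV m j
    t = ∁ (S ∪ ⁅ c ⁆) , ∣∁S∪⁅x⁆∣≡j ∣S∣≡j c∉S
    s' = (S ∪ ⁅ c ⁆) - s , trans (∣[p∪⁅y⁆]-x∣≡∣p∣ s∈S c∉S) ∣S∣≡j
    fv~t : Adj (Kneser m j) (f v) t
    fv~t x x∈fv = x∈p⇒x∉∁p (x∈p∪q⁺ (inj₁ (subst (x ∈_) fv≡S x∈fv)))
    t~s' : Adj (Kneser m j) t s'
    t~s' x x∈T x∈S' = x∈∁p⇒x∉p x∈T (proj₁ (x∈p─q⁻ x∈S'))

  InImage-all : ∀ d {S S'} → ∣ S ∣ ≡ j → ∣ S' ∣ ≡ j → ∣ S ─ S' ∣ < d → InImage S → InImage S'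
  InImage-all zero _ _ () _
  InImage-all (suc d) {S} {S'} ∣S∣≡j ∣S'∣≡j ∣S─S'∣<1+d hit with ⊆-or-∈∉ S S' | ⊆-or-∈∉ S' S
  ... | inj₁ S⊆S' | _ = subst InImage (p⊆q∧∣q∣≤∣p∣⇒p≡q S⊆S' (≤-reflexive (trans ∣S'∣≡j (sym ∣S∣≡j)))) hit
  ... | inj₂ (s , s∈S , s∉S') | inj₁ S'⊆S =
    contradiction (subst (s ∈_) (sym (p⊆q∧∣q∣≤∣p∣⇒p≡q S'⊆S (≤-reflexive (trans ∣S∣≡j (sym ∣S'∣≡j))))) s∈S) s∉S'
  ... | inj₂ (s , s∈S , s∉S') | inj₂ (c , c∈S' , c∉S) =
    InImage-all d (trans (∣[p∪⁅y⁆]-x∣≡∣p∣ s∈S c∉S) ∣S∣≡j) ∣S'∣≡j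
      (<-≤-trans shrinks (≤-pred ∣S─S'∣<1+d)) (InImage-exchange ∣S∣≡j s∈S c∉S hit)
    where
    ⊆[S─S']-s : ((S ∪ ⁅ c ⁆) - s) ─ S' ⊆ (S ─ S') - s
    ⊆[S─S']-s x∈ with x∈p─q⁻ x∈
    ... | x∈S∪⁅c⁆-s , x∉S' with x∈p─q⁻ x∈S∪⁅c⁆-s
    ...   | x∈S∪⁅c⁆ , x∉⁅s⁆ with x∈p∪q⁻ S ⁅ c ⁆ x∈S∪⁅c⁆
    ...     | inj₁ x∈S = x∈p∧x∉q⇒x∈p─q (x∈p∧x∉q⇒x∈p─q x∈S x∉S') x∉⁅s⁆
    ...     | inj₂ x∈⁅c⁆ = contradiction (subst (_∈ S') (sym (x∈⁅y⁆⇒x≡y c x∈⁅c⁆)) c∈S') x∉S'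
    shrinks : ∣ ((S ∪ ⁅ c ⁆) - s) ─ S' ∣ < ∣ S ─ S' ∣
    shrinks = ≤-<-trans (p⊆q⇒∣p∣≤∣q∣ ⊆[S─S']-s) (x∈p⇒∣p-x∣<∣p∣ (x∈p∧x∉q⇒x∈p─q s∈S s∉S'))

  surjective : V → ∀ y → ∃ λ x → f x ≡ y
  surjective v (S' , ∣S'∣≡j) =
    let (x , fx≡S') = InImage-all _ (proj₂ (f v)) ∣S'∣≡j ≤-refl (v , refl) in x , KneserV-≡ fx≡S'

module Forward {n} (G : FinGraph n) {j m} (m≡ : m ≡ j + suc j) (regular : Regular G (suc j))
               (C : StrongEdgeColouring (graph G) m) where
  open StrongEdgeColouring C
  open ColourSets G C
  open OddSize m≡

  private
    _~_ : Fin n → Fin n → Set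
    _~_ = Adj (graph G)

  colours-cover : ∀ {u v} → u ~ v → ∀ x → x ∈ colours u ⊎ x ∈ colours v
  colours-cover {u} {v} u~v x =
    x∈p∪q⁻ (colours u) (colours v) (subst (x ∈_) (sym (∣p∣≡n⇒p≡⊤ ∣∪∣≡m)) ∈⊤)
    where
    ∣∪∣≡m : ∣ colours u ∪ colours v ∣ ≡ m
    ∣∪∣≡m = ≤-antisym (∣p∣≤n (colours u ∪ colours v))
      (subst (_≤ ∣ colours u ∪ colours v ∣) (sym m≡) (≤-pred (regular⇒k+k≤1+∣colours∪colours∣ regular u~v)))

  ∁colours≡colours-col : ∀ {u v} → u ~ v → ∁ (colours v) ≡ colours u - col u v
  ∁colours≡colours-col {u} {v} u~v = ⊆-antisym ⊆colours-col ⊆∁colours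
    where
    ⊆colours-col : ∁ (colours v) ⊆ colours u - col u v
    ⊆colours-col {x} x∈∁ with colours-cover u~v x
    ... | inj₁ x∈u = x∈p∧x≢y⇒x∈p-y x∈u λ { refl → x∈∁p⇒x∉p x∈∁ (∈-colours⁺ʳ u~v) }
    ... | inj₂ x∈v = contradiction x∈v (x∈∁p⇒x∉p x∈∁)
    ⊆∁colours : colours u - col u v ⊆ ∁ (colours v)
    ⊆∁colours x∈ with x∈p─q⁻ x∈
    ... | x∈u , x∉⁅c⁆ = x∉p⇒x∈∁p λ x∈v →
      x∉⁅c⁆ (subst (_∈ ⁅ col u v ⁆) (sym (common-colour≡col u~v x∈u x∈v)) (x∈⁅x⁆ _))

  ∣colours∣≡1+j : ∀ v → ∣ colours v ∣ ≡ suc j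
  ∣colours∣≡1+j v = trans (∣colours∣≡degree v) (regular v)

  missing : Fin n → KneserV m j
  missing v = ∁ (colours v) , trans (∣∁p∣≡n∸∣p∣ (colours v)) (trans (cong (m ∸_) (∣colours∣≡1+j v)) m∸[1+j]≡j)

  missing-hom : ∀ {u v} → u ~ v → Adj (Kneser m j) (missing u) (missing v)
  missing-hom u~v x x∈∁u x∈∁v =
    x∈∁p⇒x∉p x∈∁u (proj₁ (x∈p─q⁻ (subst (x ∈_) (∁colours≡colours-col u~v) x∈∁v)))

  missing-locInj : ∀ {v w w'} → v ~ w → v ~ w' → missing w ≡ missing w' → w ≡ w'
  missing-locInj {v} {w} {w'} v~w v~w' mw≡mw' with w ≟ w'
  ... | yes w≡w' = w≡w'
  ... | no w≢w' = contradiction c∈colours-c (λ c∈ → proj₂ (x∈p─q⁻ c∈) (x∈⁅x⁆ (col v w)))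
    where
    c∈colours-c : col v w ∈ colours v - col v w
    c∈colours-c = subst (col v w ∈_) (begin
      colours v - col v w'   ≡⟨ sym (∁colours≡colours-col v~w') ⟩
      ∁ (colours w')         ≡⟨ cong proj₁ (sym mw≡mw') ⟩
      ∁ (colours w)          ≡⟨ ∁colours≡colours-col v~w ⟩
      colours v - col v w    ∎)
      (x∈p∧x≢y⇒x∈p-y (∈-colours⁺ v~w) (proper v~w v~w' w≢w'))
      where open ≡-Reasoning

  missing-locSurj : ∀ {v y} → Adj (Kneser m j) (missing v) y → ∃ λ w → v ~ w × missing w ≡ y
  missing-locSurj {v} {T , ∣T∣≡j} mv~T =
    let (x , x∈colours , T≡colours-x) = p⊆q∧1+∣p∣≡∣q∣⇒p≡q-x T⊆colours 1+∣T∣≡∣colours∣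
        (w , v~w , col≡x) = ∈-colours⁻ x∈colours
    in w , v~w , KneserV-≡ (begin
      ∁ (colours w)         ≡⟨ ∁colours≡colours-col v~w ⟩
      colours v - col v w   ≡⟨ cong (colours v -_) col≡x ⟩
      colours v - x         ≡⟨ sym T≡colours-x ⟩
      T                     ∎)
    where
    open ≡-Reasoning
    T⊆colours : T ⊆ colours v
    T⊆colours {x} x∈T = decidable-stable (x ∈? colours v) λ x∉ → mv~T x (x∉p⇒x∈∁p x∉) x∈T
    1+∣T∣≡∣colours∣ : suc ∣ T ∣ ≡ ∣ colours v ∣
    1+∣T∣≡∣colours∣ = trans (cong suc ∣T∣≡j) (sym (∣colours∣≡1+j v))

  covering : Fin n → CoveringProjection (graph G) (Kneser m j) missing
  covering v = record
    { hom        = missing-hom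
    ; surjective = KneserLift.surjective (graph G) m≡ missing missing-locSurj v
    ; locInj     = missing-locInj
    ; locSurj    = missing-locSurj
    }

alternating⇒c₁≡c₃ : ∀ {A : Set} {a b c₁ c₂ c₃ : A} → c₁ ≢ c₂ → c₂ ≢ c₃ →
  (c₁ ≡ a ⊎ c₁ ≡ b) → (c₂ ≡ a ⊎ c₂ ≡ b) → (c₃ ≡ a ⊎ c₃ ≡ b) → c₁ ≡ c₃
alternating⇒c₁≡c₃ c₁≢c₂ _ (inj₁ c₁≡a) (inj₁ c₂≡a) _ = contradiction (trans c₁≡a (sym c₂≡a)) c₁≢c₂
alternating⇒c₁≡c₃ c₁≢c₂ _ (inj₂ c₁≡b) (inj₂ c₂≡b) _ = contradiction (trans c₁≡b (sym c₂≡b)) c₁≢c₂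
alternating⇒c₁≡c₃ _ c₂≢c₃ _ (inj₁ c₂≡a) (inj₁ c₃≡a) = contradiction (trans c₂≡a (sym c₃≡a)) c₂≢c₃
alternating⇒c₁≡c₃ _ c₂≢c₃ _ (inj₂ c₂≡b) (inj₂ c₃≡b) = contradiction (trans c₂≡b (sym c₃≡b)) c₂≢c₃
alternating⇒c₁≡c₃ _ _ (inj₁ c₁≡a) (inj₂ _) (inj₁ c₃≡a) = trans c₁≡a (sym c₃≡a)
alternating⇒c₁≡c₃ _ _ (inj₂ c₁≡b) (inj₁ _) (inj₂ c₃≡b) = trans c₁≡b (sym c₃≡b)

module Backward {V : Set} (G : Graph V) {j m} (m≡ : m ≡ j + suc j)
                {f : V → KneserV m j} (cov : CoveringProjection G (Kneser m j) f) where
  open CoveringProjection cov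
  open OddSize m≡

  private
    _~_ : V → V → Set
    _~_ = Adj G

    F : V → Subset m
    F v = proj₁ (f v)

  -- On a non-edge the colour is an arbitrary default.
  col : V → V → Fin m
  col u v = outsider (fromℕ< j<m) (F u ∪ F v)

  col-sym : ∀ u v → col u v ≡ col v u
  col-sym u v = cong (outsider (fromℕ< j<m)) (∪-comm (F u) (F v))

  col∉F∪F : ∀ {u v} → u ~ v → col u v ∉ F u ∪ F v
  col∉F∪F {u} {v} u~v = outsider-∉ _ (F u ∪ F v)
    (subst (_< m) (sym (trans (∣p∪q∣≡∣p∣+∣q∣ (hom u~v)) (cong₂ _+_ (proj₂ (f u)) (proj₂ (f v)))))
           j+j<m)

  F≡∁F-col : ∀ {u v} → u ~ v → F v ≡ ∁ (F u) - col u v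
  F≡∁F-col {u} {v} u~v = p⊆q∧∣q∣≤∣p∣⇒p≡q F⊆ (≤-reflexive (suc-injective (begin
    suc ∣ ∁ (F u) - col u v ∣  ≡⟨ 1+∣p-x∣≡∣p∣ (x∉p⇒x∈∁p (col∉F∪F u~v ∘ x∈p∪q⁺ ∘ inj₁)) ⟩
    ∣ ∁ (F u) ∣                ≡⟨ ∣∁p∣≡n∸∣p∣ (F u) ⟩
    m ∸ ∣ F u ∣                ≡⟨ cong (m ∸_) (proj₂ (f u)) ⟩
    m ∸ j                      ≡⟨ m∸j≡1+j ⟩
    suc j                      ≡⟨ cong suc (sym (proj₂ (f v))) ⟩
    suc ∣ F v ∣                ∎)))
    where
    open ≡-Reasoning
    F⊆ : F v ⊆ ∁ (F u) - col u v
    F⊆ {x} x∈Fv = x∈p∧x≢y⇒x∈p-y (x∉p⇒x∈∁p λ x∈Fu → hom u~v x x∈Fu x∈Fv)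
                                 λ { refl → col∉F∪F u~v (x∈p∪q⁺ (inj₂ x∈Fv)) }

  ∉F∪F⇒≡col : ∀ {u v x} → u ~ v → x ∉ F u → x ∉ F v → x ≡ col u v
  ∉F∪F⇒≡col {u} {v} {x} u~v x∉Fu x∉Fv = decidable-stable (x ≟ col u v) λ x≢c →
    x∉Fv (subst (x ∈_) (sym (F≡∁F-col u~v)) (x∈p∧x≢y⇒x∈p-y (x∉p⇒x∈∁p x∉Fu) x≢c))

  proper : ∀ {u v w} → u ~ v → u ~ w → v ≢ w → col u v ≢ col u w
  proper {u} {v} {w} u~v u~w v≢w c≡c' = v≢w (locInj u~v u~w (KneserV-≡ (begin
    F v                  ≡⟨ F≡∁F-col u~v ⟩
    ∁ (F u) - col u v    ≡⟨ cong (∁ (F u) -_) c≡c' ⟩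
    ∁ (F u) - col u w    ≡⟨ sym (F≡∁F-col u~w) ⟩
    F w                  ∎)))
    where open ≡-Reasoning

  -- An alternating path u-v-w-x would give col u v = col w x, a colour missing from F v and F w.
  noBichromaticP3 : ∀ {u v w x} → u ~ v → v ~ w → w ~ x →
    u ≢ v → u ≢ w → u ≢ x → v ≢ w → v ≢ x → w ≢ x → ¬ Bichromatic col u v w x
  noBichromaticP3 {u} {v} {w} {x} u~v v~w w~x _ u≢w _ _ v≢x _ (_ , _ , _ , uv∈ , vw∈ , wx∈) =
    proper (Adj-sym G u~v) v~w u≢w (trans (col-sym v u) (∉F∪F⇒≡col v~w c∉Fv c∉Fw))
    where
    c≡c' : col u v ≡ col w x
    c≡c' = alternating⇒c₁≡c₃
      (λ c≡ → proper (Adj-sym G u~v) v~w u≢w (trans (col-sym v u) c≡))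
      (λ c≡ → proper (Adj-sym G v~w) w~x v≢x (trans (col-sym w v) c≡)) uv∈ vw∈ wx∈
    c∉Fv : col u v ∉ F v
    c∉Fv = col∉F∪F u~v ∘ x∈p∪q⁺ ∘ inj₂
    c∉Fw : col u v ∉ F w
    c∉Fw = col∉F∪F w~x ∘ x∈p∪q⁺ ∘ inj₁ ∘ subst (_∈ F w) c≡c'

  colouring : StrongEdgeColouring G m
  colouring = record
    { col             = col
    ; col-sym         = λ {u} {v} _ → col-sym u v
    ; proper          = proper
    ; noBichromaticP3 = noBichromaticP3
    }

positive-index⇒vertex : ∀ {n} (G : FinGraph n) {m} → 0 < m → StrongChromaticIndex (graph G) m → Fin n
positive-index⇒vertex {zero} G 0<m (_ , minimal) = contradiction (minimal 0 no-colours) (<⇒≱ 0<m)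
  where
  no-colours : StrongEdgeColouring (graph G) 0
  no-colours = record
    { col = λ () ; col-sym = λ { {()} } ; proper = λ { {()} } ; noBichromaticP3 = λ { {()} } }
positive-index⇒vertex {suc n} _ _ _ = zero

χ'ₛ≡2k∸1⇔covers-Kneser : ∀ j {n} (G : FinGraph n) → Regular G (suc j) →
  StrongChromaticIndex (graph G) (2 * suc j ∸ 1) ⇔ Covers (graph G) (Kneser (2 * suc j ∸ 1) j)
χ'ₛ≡2k∸1⇔covers-Kneser j G regular = mk⇔
  (λ index@(C , _) → Forward.missing G m≡ regular C ,
                     Forward.covering G m≡ regular C (positive-index⇒vertex G (≤-<-trans z≤n j<m) index))
  (λ (f , cov) → Backward.colouring (graph G) m≡ cov , minimal cov)
  where
  m≡ : 2 * suc j ∸ 1 ≡ j + suc j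
  m≡ = cong (j +_) (+-identityʳ (suc j))
  open OddSize m≡ using (j<m)
  minimal : ∀ {f} → CoveringProjection (graph G) (Kneser (2 * suc j ∸ 1) j) f →
    ∀ m' → StrongEdgeColouring (graph G) m' → 2 * suc j ∸ 1 ≤ m'
  minimal cov m' C = subst (_≤ m') (sym m≡) (regular⇒2k∸1≤colours G regular v₀ C)
    where v₀ = proj₁ (CoveringProjection.surjective cov (subset-of-size (<⇒≤ j<m)))

-- The hypothesis k ≥ 3 only rules out k = 0: the equivalence holds for every k ≥ 1.
theorem4 : (k : ℕ) → 3 ≤ k → (n : ℕ) (G : FinGraph n) → Regular G k →
    StrongChromaticIndex (graph G) (2 * k ∸ 1) ⇔ Covers (graph G) (Kneser (2 * k ∸ 1) (k ∸ 1))
theorem4 zero () _ _ _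
theorem4 (suc j) _ _ G regular = χ'ₛ≡2k∸1⇔covers-Kneser j G regular
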